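{- Let $m\ge 2$ and $n\ge 1$. There is a bijection between the set of small $m$-Schröder paths from $(0,\dots,0)$ to $(n,\dots,n)$ and the set of all increasing tableaux of shape $m\times n$ (i.e. $\bigcup_{k\ge 0}\mathrm{Inc}_k(m\times n)$).
   Context: An increasing tableau of shape $m\times n$ (rectangle with $m$ rows and $n$ columns) is a filling of the boxes with positive integers such that rows and columns are strictly increasing and, if $M$ is the largest entry, every integer $1,\dots,M$ appears at least once; $\mathrm{Inc}_k(m\times n)$ is the set of those with largest entry $mn-k$. A large $m$-Schröder path is a lattice path in $\mathbb{R}^m$ from $(0,\dots,0)$ to $(n,\dots,n)$ whose steps are nonzero vectors $(\xi_1,\dots,\xi_m)$ with each $\xi_i\in\{0,1\}$, and which lies in the region $\{(x_1,\dots,x_m): 0\le x_m\le x_{m-1}\le\cdots\le x_1\}$. A small $m$-Schröder path is a large $m$-Schröder path such that whenever the path, after some number of steps, is at a point $(x_1,\dots,x_m)$ with $x_j=x_{j+1}$, the next step $(\xi_1,\dots,\xi_m)$ does not have $\xi_j=\xi_{j+1}=1$. -}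

module Defs where

open import Level using (0ℓ)
open import Data.Nat using (ℕ; zero; suc; _+_; _*_; _∸_; _≤_; _<_)
open import Data.Bool using (Bool; true; false)
open import Data.Fin using (Fin; toℕ)
open import Data.Vec using (Vec; lookup; replicate; zipWith)
open import Data.List using (List; []; _∷_; length; take)
import Data.List as L
open import Data.Product using (Σ; ∃; ∃-syntax; _×_; _,_; proj₁)
open import Relation.Nullary using (¬_)
open import Relation.Binary.Bundles using (Setoid)
open import Relation.Binary.PropositionalEquality using (_≡_)
import Relation.Binary.PropositionalEquality as P
import Relation.Binary.Construct.On as On

Filling : ℕ → ℕ → Set
Filling m n = Vec (Vec ℕ n) m

entry : ∀ {m n} → Filling m n → Fin m → Fin n → ℕ
entry T i j = lookup (lookup T i) j

Positive : ∀ {m n} → Filling m n → Set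
Positive T = ∀ i j → 1 ≤ entry T i j

RowsIncreasing : ∀ {m n} → Filling m n → Set
RowsIncreasing {m} {n} T =
  ∀ (i : Fin m) (j j′ : Fin n) → toℕ j′ ≡ suc (toℕ j) → entry T i j < entry T i j′

ColumnsIncreasing : ∀ {m n} → Filling m n → Set
ColumnsIncreasing {m} {n} T =
  ∀ (i i′ : Fin m) (j : Fin n) → toℕ i′ ≡ suc (toℕ i) → entry T i j < entry T i′ j

IsLargestEntry : ∀ {m n} → Filling m n → ℕ → Set
IsLargestEntry T M = (∃[ i ] ∃[ j ] entry T i j ≡ M) × (∀ i j → entry T i j ≤ M)

AllUpToAppear : ∀ {m n} → Filling m n → ℕ → Set
AllUpToAppear T M = ∀ k → 1 ≤ k → k ≤ M → ∃[ i ] ∃[ j ] entry T i j ≡ k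

IsIncreasingTableau : ∀ {m n} → Filling m n → ℕ → Set
IsIncreasingTableau T M =
  Positive T × RowsIncreasing T × ColumnsIncreasing T ×
  IsLargestEntry T M × AllUpToAppear T M

Inc : ℕ → ℕ → ℕ → Set
Inc k m n = Σ (Filling m n) λ T → IsIncreasingTableau T (m * n ∸ k)

-- ⋃_{k ≥ 0} Inc_k(m × n)   (a disjoint union; elements compared by their filling)
AllInc : ℕ → ℕ → Set
AllInc m n = Σ ℕ λ k → Inc k m n

fillingOf : ∀ {m n} → AllInc m n → Filling m n
fillingOf (k , T , _) = T

AllIncSetoid : ℕ → ℕ → Setoid 0ℓ 0ℓ
AllIncSetoid m n = On.setoid (P.setoid (Filling m n)) (fillingOf {m} {n})

Step : ℕ → Set
Step m = Vec Bool m

NonzeroStep : ∀ {m} → Step m → Set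
NonzeroStep {m} s = ∃[ i ] lookup s i ≡ true

bit : Bool → ℕ
bit true  = 1
bit false = 0

Point : ℕ → Set
Point m = Vec ℕ m

addStep : ∀ {m} → Point m → Step m → Point m
addStep x s = zipWith (λ a b → a + bit b) x s

position : ∀ {m} → List (Step m) → Point m
position {m} []       = replicate m 0
position {m} (s ∷ ss) = addStep (position ss) s
-- (note: `position` is independent of order; it is the sum of the steps)

-- the region 0 ≤ x_m ≤ x_{m-1} ≤ ⋯ ≤ x_1  (x_{i+1} ≤ x_i; nonnegativity is automatic in ℕ)
InRegion : ∀ {m} → Point m → Set
InRegion {m} x = ∀ (i i′ : Fin m) → toℕ i′ ≡ suc (toℕ i) → lookup x i′ ≤ lookup x i

Path : ℕ → Set
Path m = List (Step m)

after : ∀ {m} → Path m → ℕ → Point m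
after p k = position (take k p)

stepAt : ∀ {m} (p : Path m) → Fin (length p) → Step m
stepAt p k = L.lookup p k

IsLargeSchroder : ∀ {m} → ℕ → Path m → Set
IsLargeSchroder {m} n p =
  (∀ k → NonzeroStep (stepAt p k)) ×
  (∀ k → k ≤ length p → InRegion (after p k)) ×
  position p ≡ replicate m n

SmallCondition : ∀ {m} → Path m → Set
SmallCondition {m} p =
  ∀ (k : Fin (length p)) (i i′ : Fin m) → toℕ i′ ≡ suc (toℕ i) →
    lookup (after p (toℕ k)) i ≡ lookup (after p (toℕ k)) i′ →
    ¬ (lookup (stepAt p k) i ≡ true × lookup (stepAt p k) i′ ≡ true)

SmallSchroder : ℕ → ℕ → Set
SmallSchroder m n = Σ (Path m) λ p → IsLargeSchroder n p × SmallCondition p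

pathOf : ∀ {m n} → SmallSchroder m n → Path m
pathOf = proj₁

SmallSchroderSetoid : ℕ → ℕ → Setoid 0ℓ 0ℓ
SmallSchroderSetoid m n = On.setoid (P.setoid (Path m)) (pathOf {m} {n})

-- Record a path of length M by its m coordinate words in {0,1}^M: word i marks the times at
-- which coordinate i increases and contains exactly n ones. Row i of the tableau lists these n
-- times, counted from 1. Rows then increase automatically, nonzero steps make every time
-- 1, …, M occur, and M is the largest entry. For consecutive coordinates i, i+1 the region
-- condition says that word i+1 never has more ones than word i in a prefix, and the small
-- condition forbids a joint one where the prefix counts tie; together these say exactly that
-- the j-th one of word i strictly precedes the j-th one of word i+1, i.e. that columns increase.
-- Conversely a tableau with largest entry M gives the path whose t-th step marks the rows
-- containing t.

module Submission where

open import Data.Nat using (ℕ; zero; suc; _+_; _*_; _∸_; _≤_; _<_; z≤n; s≤s; _≟_)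
open import Data.Nat.Properties
open import Data.Bool using (Bool; true; false; _∨_)
open import Data.List using (List; []; _∷_; length; take; map)
open import Data.List.Properties using (take-map; length-map; map-∘; map-cong; ∷-injectiveˡ; ∷-injectiveʳ)
open import Data.Fin using (Fin; toℕ; fromℕ<) renaming (zero to fzero; suc to fsuc)
open import Data.Fin.Properties using (toℕ-fromℕ<; toℕ<n)
open import Data.Vec using (Vec; []; _∷_; lookup; replicate; tabulate; sum)
open import Data.Vec.Properties
  using (lookup∘tabulate; tabulate∘lookup; tabulate-cong; lookup-zipWith; lookup-replicate)
open import Data.Vec.Relation.Binary.Pointwise.Extensional using (ext; Pointwise-≡⇒≡)
open import Data.Product using (∃-syntax; _×_; _,_; proj₁; proj₂)
open import Data.Unit using (⊤; tt)
open import Data.Empty using (⊥; ⊥-elim)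
open import Function using (_∘_)
open import Function.Bundles using (Bijection)
open import Relation.Nullary using (yes; no; does)
open import Relation.Nullary.Decidable using (dec-true; dec-false)
open import Relation.Binary.PropositionalEquality
open import Defs

ones : List Bool → ℕ
ones []          = 0
ones (true ∷ b)  = suc (ones b)
ones (false ∷ b) = ones b

onesBefore : ℕ → List Bool → ℕ
onesBefore k b = ones (take k b)

bitAt : List Bool → ℕ → Bool
bitAt []      _       = false
bitAt (x ∷ b) zero    = x
bitAt (x ∷ b) (suc k) = bitAt b k

-- Position of the one numbered j, both counted from 0 (indexOfOne b 0 is where the first true
-- sits); a junk value when b has at most j ones.
indexOfOne : List Bool → ℕ → ℕ
indexOfOne []          j       = 0
indexOfOne (true ∷ b)  zero    = 0
indexOfOne (true ∷ b)  (suc j) = suc (indexOfOne b j)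
indexOfOne (false ∷ b) j       = suc (indexOfOne b j)

indexOfOne<length : ∀ b {j} → j < ones b → indexOfOne b j < length b
indexOfOne<length (true ∷ b)  {zero}  _ = s≤s z≤n
indexOfOne<length (true ∷ b)  {suc j} h = s≤s (indexOfOne<length b (≤-pred h))
indexOfOne<length (false ∷ b)         h = s≤s (indexOfOne<length b h)

indexOfOne-strictMono : ∀ b {j} → suc j < ones b → indexOfOne b j < indexOfOne b (suc j)
indexOfOne-strictMono (true ∷ b)  {zero}  _ = s≤s z≤n
indexOfOne-strictMono (true ∷ b)  {suc j} h = s≤s (indexOfOne-strictMono b (≤-pred h))
indexOfOne-strictMono (false ∷ b)         h = s≤s (indexOfOne-strictMono b h)

indexOfOne<-onesBefore : ∀ b {j} k → j < onesBefore k b → indexOfOne b j < k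
indexOfOne<-onesBefore (true ∷ b)  {zero}  (suc k) _ = s≤s z≤n
indexOfOne<-onesBefore (true ∷ b)  {suc j} (suc k) h = s≤s (indexOfOne<-onesBefore b k (≤-pred h))
indexOfOne<-onesBefore (false ∷ b)         (suc k) h = s≤s (indexOfOne<-onesBefore b k h)

onesBefore-indexOfOne : ∀ b {j} → j < ones b → onesBefore (indexOfOne b j) b ≡ j
onesBefore-indexOfOne (true ∷ b)  {zero}  _ = refl
onesBefore-indexOfOne (true ∷ b)  {suc j} h = cong suc (onesBefore-indexOfOne b (≤-pred h))
onesBefore-indexOfOne (false ∷ b)         h = onesBefore-indexOfOne b h

onesBefore-suc-indexOfOne : ∀ b {j} → j < ones b → onesBefore (suc (indexOfOne b j)) b ≡ suc j
onesBefore-suc-indexOfOne (true ∷ b)  {zero}  _ = refl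
onesBefore-suc-indexOfOne (true ∷ b)  {suc j} h = cong suc (onesBefore-suc-indexOfOne b (≤-pred h))
onesBefore-suc-indexOfOne (false ∷ b)         h = onesBefore-suc-indexOfOne b h

bitAt-indexOfOne : ∀ b {j} → j < ones b → bitAt b (indexOfOne b j) ≡ true
bitAt-indexOfOne (true ∷ b)  {zero}  _ = refl
bitAt-indexOfOne (true ∷ b)  {suc j} h = bitAt-indexOfOne b (≤-pred h)
bitAt-indexOfOne (false ∷ b)         h = bitAt-indexOfOne b h

indexOfOne-onesBefore : ∀ b k → bitAt b k ≡ true → indexOfOne b (onesBefore k b) ≡ k
indexOfOne-onesBefore (true ∷ b)  zero    _ = refl
indexOfOne-onesBefore (true ∷ b)  (suc k) h = cong suc (indexOfOne-onesBefore b k h)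
indexOfOne-onesBefore (false ∷ b) (suc k) h = cong suc (indexOfOne-onesBefore b k h)

onesBefore<ones : ∀ b k → bitAt b k ≡ true → onesBefore k b < ones b
onesBefore<ones (true ∷ b)  zero    _ = s≤s z≤n
onesBefore<ones (true ∷ b)  (suc k) h = s≤s (onesBefore<ones b k h)
onesBefore<ones (false ∷ b) (suc k) h = onesBefore<ones b k h

onesBefore-mono : ∀ b {k k′} → k ≤ k′ → onesBefore k b ≤ onesBefore k′ b
onesBefore-mono b           {zero}          _       = z≤n
onesBefore-mono []          {suc k} {suc k′} _       = z≤n
onesBefore-mono (true ∷ b)  {suc k} {suc k′} (s≤s h) = s≤s (onesBefore-mono b h)
onesBefore-mono (false ∷ b) {suc k} {suc k′} (s≤s h) = onesBefore-mono b h

onesBefore≤ones : ∀ b k → onesBefore k b ≤ ones b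
onesBefore≤ones b           zero    = z≤n
onesBefore≤ones []          (suc k) = z≤n
onesBefore≤ones (true ∷ b)  (suc k) = s≤s (onesBefore≤ones b k)
onesBefore≤ones (false ∷ b) (suc k) = onesBefore≤ones b k

ones≤length : ∀ b → ones b ≤ length b
ones≤length []          = z≤n
ones≤length (true ∷ b)  = s≤s (ones≤length b)
ones≤length (false ∷ b) = m≤n⇒m≤1+n (ones≤length b)

OnesPrecede : List Bool → List Bool → Set
OnesPrecede b b′ = ∀ {j} → j < ones b′ → indexOfOne b j < indexOfOne b′ j

-- If the one numbered j of b′ were not later than that of b, then b, dominating b′ just after
-- that one, would have its own one numbered j at the same place: a joint one at a tie.
dominance⇒onesPrecede : ∀ b b′ →
  (∀ k → k ≤ length b′ → onesBefore k b′ ≤ onesBefore k b) →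
  (∀ k → k < length b′ → onesBefore k b ≡ onesBefore k b′ →
     bitAt b k ≡ true → bitAt b′ k ≡ true → ⊥) →
  OnesPrecede b b′
dominance⇒onesPrecede b b′ dominates noTie {j} j<ones′
  with indexOfOne b j <? indexOfOne b′ j
... | yes t<t′ = t<t′
... | no t≮t′ = ⊥-elim (noTie t′ (indexOfOne<length b′ j<ones′) sameCount
                          (subst (λ x → bitAt b x ≡ true) t≡t′ (bitAt-indexOfOne b j<ones))
                          (bitAt-indexOfOne b′ j<ones′))
  where
    t′ = indexOfOne b′ j
    j<onesBefore : j < onesBefore (suc t′) b
    j<onesBefore = subst (_≤ onesBefore (suc t′) b) (onesBefore-suc-indexOfOne b′ j<ones′)
                     (dominates (suc t′) (indexOfOne<length b′ j<ones′))
    j<ones : j < ones b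
    j<ones = <-≤-trans j<onesBefore (onesBefore≤ones b (suc t′))
    t≡t′ : indexOfOne b j ≡ t′
    t≡t′ = ≤-antisym (≤-pred (indexOfOne<-onesBefore b (suc t′) j<onesBefore)) (≮⇒≥ t≮t′)
    sameCount : onesBefore t′ b ≡ onesBefore t′ b′
    sameCount = begin
      onesBefore t′ b                 ≡⟨ cong (λ x → onesBefore x b) (sym t≡t′) ⟩
      onesBefore (indexOfOne b j) b   ≡⟨ onesBefore-indexOfOne b j<ones ⟩
      j                               ≡⟨ sym (onesBefore-indexOfOne b′ j<ones′) ⟩
      onesBefore t′ b′                ∎
      where open ≡-Reasoning

onesPrecede⇒dominance : ∀ b b′ → ones b ≡ ones b′ → OnesPrecede b b′ →
  ∀ k → onesBefore k b′ ≤ onesBefore k b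
onesPrecede⇒dominance b b′ sameOnes precede k with onesBefore k b′ in count′
... | zero  = z≤n
... | suc j = begin
  suc j                               ≡⟨ onesBefore-suc-indexOfOne b j<ones ⟨
  onesBefore (suc (indexOfOne b j)) b ≤⟨ onesBefore-mono b (<-trans (precede j<ones′) t′<k) ⟩
  onesBefore k b                      ∎
  where
    open ≤-Reasoning
    j<ones′ : j < ones b′
    j<ones′ = subst (_≤ ones b′) count′ (onesBefore≤ones b′ k)
    j<ones : j < ones b
    j<ones = subst (j <_) (sym sameOnes) j<ones′
    t′<k : indexOfOne b′ j < k
    t′<k = indexOfOne<-onesBefore b′ k (≤-reflexive (sym count′))

onesPrecede⇒noJointOneAtTie : ∀ b b′ → OnesPrecede b b′ →
  ∀ k → onesBefore k b ≡ onesBefore k b′ → bitAt b k ≡ true → bitAt b′ k ≡ true → ⊥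
onesPrecede⇒noJointOneAtTie b b′ precede k sameCount one one′ = <-irrefl refl (begin-strict
  k                                   ≡⟨ indexOfOne-onesBefore b k one ⟨
  indexOfOne b (onesBefore k b)       <⟨ precede (subst (_< ones b′) (sym sameCount) (onesBefore<ones b′ k one′)) ⟩
  indexOfOne b′ (onesBefore k b)      ≡⟨ cong (indexOfOne b′) sameCount ⟩
  indexOfOne b′ (onesBefore k b′)     ≡⟨ indexOfOne-onesBefore b′ k one′ ⟩
  k                                   ∎)
  where open ≤-Reasoning

_∈ᵇ_ : ∀ {k} → ℕ → Vec ℕ k → Bool
t ∈ᵇ []      = false
t ∈ᵇ (x ∷ S) = does (t ≟ x) ∨ t ∈ᵇ S

interval : ℕ → ℕ → List ℕ
interval a zero    = []
interval a (suc L) = a ∷ interval (suc a) L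

length-interval : ∀ a L → length (interval a L) ≡ L
length-interval a zero    = refl
length-interval a (suc L) = cong suc (length-interval (suc a) L)

indicator : ∀ {k} → Vec ℕ k → ℕ → ℕ → List Bool
indicator S a L = map (_∈ᵇ S) (interval a L)

IncreasingFrom : ∀ {k} → ℕ → Vec ℕ k → Set
IncreasingFrom a []      = ⊤
IncreasingFrom a (x ∷ S) = a ≤ x × IncreasingFrom (suc x) S

IncreasingFrom-weaken : ∀ {k} a (S : Vec ℕ k) → IncreasingFrom (suc a) S → IncreasingFrom a S
IncreasingFrom-weaken a []      _         = tt
IncreasingFrom-weaken a (x ∷ S) (a<x , S↑) = <⇒≤ a<x , S↑

StrictlyIncreasing : ∀ {k} → Vec ℕ k → Set
StrictlyIncreasing {k} S = ∀ (j j′ : Fin k) → toℕ j′ ≡ suc (toℕ j) → lookup S j < lookup S j′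

strictlyIncreasing-tail : ∀ {k} x (S : Vec ℕ k) → StrictlyIncreasing (x ∷ S) → StrictlyIncreasing S
strictlyIncreasing-tail x S inc j j′ e = inc (fsuc j) (fsuc j′) (cong suc e)

head<tail : ∀ {k} x (S : Vec ℕ k) → StrictlyIncreasing (x ∷ S) → ∀ j → x < lookup S j
head<tail x (y ∷ S) inc fzero    = inc fzero (fsuc fzero) refl
head<tail x (y ∷ S) inc (fsuc j) =
  <-trans (inc fzero (fsuc fzero) refl) (head<tail y S (strictlyIncreasing-tail x (y ∷ S) inc) j)

strictlyIncreasing⇒IncreasingFrom : ∀ {k} a (S : Vec ℕ k) → (∀ j → a ≤ lookup S j) →
  StrictlyIncreasing S → IncreasingFrom a S
strictlyIncreasing⇒IncreasingFrom a []      _     _   = tt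
strictlyIncreasing⇒IncreasingFrom a (x ∷ S) above inc =
  above fzero , strictlyIncreasing⇒IncreasingFrom (suc x) S (head<tail x S inc)
                  (strictlyIncreasing-tail x S inc)

∉-below : ∀ {k} c (S : Vec ℕ k) t → IncreasingFrom c S → t < c → t ∈ᵇ S ≡ false
∉-below c []      t _           _   = refl
∉-below c (x ∷ S) t (c≤x , S↑) t<c
  rewrite dec-false (t ≟ x) (λ t≡x → <-irrefl t≡x (<-≤-trans t<c c≤x)) =
  ∉-below (suc x) S t S↑ (<-trans t<c (s≤s c≤x))

indicator-∷-below : ∀ {k} x (S : Vec ℕ k) c L → x < c → indicator (x ∷ S) c L ≡ indicator S c L
indicator-∷-below x S c zero    _   = refl
indicator-∷-below x S c (suc L) x<c
  rewrite dec-false (c ≟ x) (λ c≡x → <-irrefl (sym c≡x) x<c) =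
  cong (c ∈ᵇ S ∷_) (indicator-∷-below x S (suc c) L (m≤n⇒m≤1+n x<c))

ones-indicator-[] : ∀ a L → ones (indicator [] a L) ≡ 0
ones-indicator-[] a zero    = refl
ones-indicator-[] a (suc L) = ones-indicator-[] (suc a) L

Fits : ∀ {k} → Vec ℕ k → ℕ → ℕ → Set
Fits S a L = IncreasingFrom a S × (∀ j → lookup S j < a + L)

fits-∷-absurd : ∀ {k} x (S : Vec ℕ k) a → Fits (x ∷ S) a 0 → ⊥
fits-∷-absurd x S a ((a≤x , _) , below) =
  <-irrefl refl (<-≤-trans (subst (x <_) (+-identityʳ a) (below fzero)) a≤x)

fits-tail : ∀ {k} (S : Vec ℕ k) a L → Fits (a ∷ S) a (suc L) → Fits S (suc a) L
fits-tail S a L ((_ , S↑) , below) = S↑ , λ j → subst (lookup S j <_) (+-suc a L) (below (fsuc j))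

fits-shift : ∀ {k} x (S : Vec ℕ k) a L → a ≢ x → Fits (x ∷ S) a (suc L) → Fits (x ∷ S) (suc a) L
fits-shift x S a L a≢x ((a≤x , S↑) , below) =
  (≤∧≢⇒< a≤x a≢x , S↑) , λ j → subst (lookup (x ∷ S) j <_) (+-suc a L) (below j)

ones-indicator : ∀ {k} (S : Vec ℕ k) a L → Fits S a L → ones (indicator S a L) ≡ k
ones-indicator []      a L       _ = ones-indicator-[] a L
ones-indicator (x ∷ S) a zero    f = ⊥-elim (fits-∷-absurd x S a f)
ones-indicator (x ∷ S) a (suc L) f@((a≤x , S↑) , _) with a ≟ x
... | yes refl rewrite dec-true (a ≟ a) refl | indicator-∷-below a S (suc a) L ≤-refl =
  cong suc (ones-indicator S (suc a) L (fits-tail S a L f))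
... | no a≢x rewrite dec-false (a ≟ x) a≢x | ∉-below (suc x) S a S↑ (s≤s a≤x) =
  ones-indicator (x ∷ S) (suc a) L (fits-shift x S a L a≢x f)

indexOfOne-indicator : ∀ {k} (S : Vec ℕ k) a L → Fits S a L →
  ∀ j → a + indexOfOne (indicator S a L) (toℕ j) ≡ lookup S j
indexOfOne-indicator (x ∷ S) a zero    f j = ⊥-elim (fits-∷-absurd x S a f)
indexOfOne-indicator (x ∷ S) a (suc L) f@((a≤x , S↑) , _) j with a ≟ x
... | yes refl rewrite dec-true (a ≟ a) refl | indicator-∷-below a S (suc a) L ≤-refl = shifted j
  where
    shifted : ∀ j → a + indexOfOne (true ∷ indicator S (suc a) L) (toℕ j) ≡ lookup (a ∷ S) j
    shifted fzero    = +-identityʳ a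
    shifted (fsuc j) = trans (+-suc a _) (indexOfOne-indicator S (suc a) L (fits-tail S a L f) j)
... | no a≢x rewrite dec-false (a ≟ x) a≢x | ∉-below (suc x) S a S↑ (s≤s a≤x) =
  trans (+-suc a _) (indexOfOne-indicator (x ∷ S) (suc a) L (fits-shift x S a L a≢x f) j)

positionsOfOnes : ℕ → (b : List Bool) → Vec ℕ (ones b)
positionsOfOnes o []          = []
positionsOfOnes o (true ∷ b)  = o ∷ positionsOfOnes (suc o) b
positionsOfOnes o (false ∷ b) = positionsOfOnes (suc o) b

lookup-positionsOfOnes : ∀ o b j → lookup (positionsOfOnes o b) j ≡ o + indexOfOne b (toℕ j)
lookup-positionsOfOnes o (true ∷ b)  fzero    = sym (+-identityʳ o)
lookup-positionsOfOnes o (true ∷ b)  (fsuc j) = trans (lookup-positionsOfOnes (suc o) b j) (sym (+-suc o _))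
lookup-positionsOfOnes o (false ∷ b) j        = trans (lookup-positionsOfOnes (suc o) b j) (sym (+-suc o _))

positionsOfOnes-increasing : ∀ o b → IncreasingFrom o (positionsOfOnes o b)
positionsOfOnes-increasing o []          = tt
positionsOfOnes-increasing o (true ∷ b)  = ≤-refl , positionsOfOnes-increasing (suc o) b
positionsOfOnes-increasing o (false ∷ b) =
  IncreasingFrom-weaken o _ (positionsOfOnes-increasing (suc o) b)

indicator-positionsOfOnes : ∀ o b → indicator (positionsOfOnes o b) o (length b) ≡ b
indicator-positionsOfOnes o [] = refl
indicator-positionsOfOnes o (true ∷ b) rewrite dec-true (o ≟ o) refl =
  cong (true ∷_) (trans (indicator-∷-below o (positionsOfOnes (suc o) b) (suc o) (length b) ≤-refl)
                        (indicator-positionsOfOnes (suc o) b))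
indicator-positionsOfOnes o (false ∷ b) =
  cong₂ _∷_ (∉-below (suc o) (positionsOfOnes (suc o) b) o (positionsOfOnes-increasing (suc o) b) ≤-refl)
            (indicator-positionsOfOnes (suc o) b)

entriesOf : ∀ {n} → List Bool → Vec ℕ n
entriesOf b = tabulate (λ j → suc (indexOfOne b (toℕ j)))

indicator-entriesOf : ∀ {n} b → ones b ≡ n → indicator (entriesOf {n} b) 1 (length b) ≡ b
indicator-entriesOf b refl = begin
  indicator (entriesOf {ones b} b) 1 (length b)  ≡⟨ cong (λ S → indicator S 1 (length b)) entries≡positions ⟩
  indicator (positionsOfOnes 1 b) 1 (length b)   ≡⟨ indicator-positionsOfOnes 1 b ⟩
  b                                              ∎
  where
    open ≡-Reasoning
    entries≡positions : entriesOf b ≡ positionsOfOnes 1 b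
    entries≡positions = trans (tabulate-cong (λ j → sym (lookup-positionsOfOnes 1 b j)))
                              (tabulate∘lookup (positionsOfOnes 1 b))

coordinate : ∀ {m} → Fin m → Path m → List Bool
coordinate i = map (λ s → lookup s i)

length-coordinate : ∀ {m} (i : Fin m) p → length (coordinate i p) ≡ length p
length-coordinate i p = length-map _ p

ones-∷ : ∀ x b → ones (x ∷ b) ≡ ones b + bit x
ones-∷ true  b = +-comm 1 (ones b)
ones-∷ false b = sym (+-identityʳ (ones b))

lookup-position : ∀ {m} (p : Path m) i → lookup (position p) i ≡ ones (coordinate i p)
lookup-position {m} []       i = lookup-replicate i 0
lookup-position     (s ∷ ss) i = begin
  lookup (addStep (position ss) s) i         ≡⟨ lookup-zipWith _ i (position ss) s ⟩
  lookup (position ss) i + bit (lookup s i)  ≡⟨ cong (_+ bit (lookup s i)) (lookup-position ss i) ⟩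
  ones (coordinate i ss) + bit (lookup s i)  ≡⟨ ones-∷ (lookup s i) (coordinate i ss) ⟨
  ones (coordinate i (s ∷ ss))               ∎
  where open ≡-Reasoning

lookup-after : ∀ {m} (p : Path m) k i → lookup (after p k) i ≡ onesBefore k (coordinate i p)
lookup-after p k i = trans (lookup-position (take k p) i) (cong ones (sym (take-map k p)))

lookup-stepAt : ∀ {m} (p : Path m) k i → lookup (stepAt p k) i ≡ bitAt (coordinate i p) (toℕ k)
lookup-stepAt (s ∷ p) fzero    i = refl
lookup-stepAt (s ∷ p) (fsuc k) i = lookup-stepAt p k i

coordinate-injective : ∀ {m} → Fin m → (p q : Path m) → (∀ i → coordinate i p ≡ coordinate i q) → p ≡ q
coordinate-injective i₀ []      []      _ = refl
coordinate-injective i₀ []      (_ ∷ _) h with () ← h i₀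
coordinate-injective i₀ (_ ∷ _) []      h with () ← h i₀
coordinate-injective i₀ (s ∷ p) (s′ ∷ q) h =
  cong₂ _∷_ (Pointwise-≡⇒≡ (ext (λ i → ∷-injectiveˡ (h i))))
            (coordinate-injective i₀ p q (λ i → ∷-injectiveʳ (h i)))

sum-addStep-mono : ∀ {m} (x : Point m) s → sum x ≤ sum (addStep x s)
sum-addStep-mono []      []      = z≤n
sum-addStep-mono (a ∷ x) (b ∷ s) = +-mono-≤ (m≤m+n a (bit b)) (sum-addStep-mono x s)

sum-addStep-strict : ∀ {m} (x : Point m) s → NonzeroStep s → sum x < sum (addStep x s)
sum-addStep-strict (a ∷ x) (true ∷ s) (fzero , refl) =
  +-mono-<-≤ (m<m+n a (s≤s z≤n)) (sum-addStep-mono x s)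
sum-addStep-strict (a ∷ x) (b ∷ s) (fsuc i , one) =
  +-mono-≤-< (m≤m+n a (bit b)) (sum-addStep-strict x s (i , one))

length≤sum-position : ∀ {m} (p : Path m) → (∀ k → NonzeroStep (stepAt p k)) → length p ≤ sum (position p)
length≤sum-position []      _       = z≤n
length≤sum-position (s ∷ p) nonzero =
  ≤-trans (s≤s (length≤sum-position p (λ k → nonzero (fsuc k))))
          (sum-addStep-strict (position p) s (nonzero fzero))

sum-replicate : ∀ m n → sum (replicate m n) ≡ m * n
sum-replicate zero    n = refl
sum-replicate (suc m) n = cong (n +_) (sum-replicate m n)

tableauOf : ∀ {m n} → Path m → Filling m n
tableauOf p = tabulate (λ i → entriesOf (coordinate i p))

entry-tableauOf : ∀ {m n} (p : Path m) i (j : Fin n) →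
  entry (tableauOf p) i j ≡ suc (indexOfOne (coordinate i p) (toℕ j))
entry-tableauOf p i j = trans (cong (λ r → lookup r j) (lookup∘tabulate _ i)) (lookup∘tabulate _ j)

stepAtTime : ∀ {m n} → Filling m n → ℕ → Step m
stepAtTime T t = tabulate (λ i → t ∈ᵇ lookup T i)

pathFrom : ∀ {m n} → Filling m n → ℕ → Path m
pathFrom T M = map (stepAtTime T) (interval 1 M)

length-pathFrom : ∀ {m n} (T : Filling m n) M → length (pathFrom T M) ≡ M
length-pathFrom T M = trans (length-map _ (interval 1 M)) (length-interval 1 M)

coordinate-pathFrom : ∀ {m n} (T : Filling m n) M i → coordinate i (pathFrom T M) ≡ indicator (lookup T i) 1 M
coordinate-pathFrom T M i =
  trans (sym (map-∘ (interval 1 M))) (map-cong (λ t → lookup∘tabulate _ i) (interval 1 M))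

largestEntry-unique : ∀ {m n} (T : Filling m n) {M M′} → IsLargestEntry T M → IsLargestEntry T M′ → M ≡ M′
largestEntry-unique T ((i , j , Tij≡M) , below) ((i′ , j′ , Ti′j′≡M′) , below′) =
  ≤-antisym (subst (_≤ _) Tij≡M (below′ i j)) (subst (_≤ _) Ti′j′≡M′ (below i′ j′))

filling-ext : ∀ {m n} (T T′ : Filling m n) → (∀ i j → entry T i j ≡ entry T′ i j) → T ≡ T′
filling-ext T T′ h = Pointwise-≡⇒≡ (ext (λ i → Pointwise-≡⇒≡ (ext (h i))))

∀Fin⇒∀< : ∀ {L} {P : ℕ → Set} → (∀ (K : Fin L) → P (toℕ K)) → ∀ k → k < L → P k
∀Fin⇒∀< {P = P} f k k<L = subst P (toℕ-fromℕ< k<L) (f (fromℕ< k<L))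

module PathToTableau {m n : ℕ} (m≥1 : 1 ≤ m) (n≥1 : 1 ≤ n) (p : Path m)
  (nonzero : ∀ k → NonzeroStep (stepAt p k)) (inRegion : ∀ k → k ≤ length p → InRegion (after p k))
  (ends : position p ≡ replicate m n) (small : SmallCondition p) where

  ones-coordinate : ∀ i → ones (coordinate i p) ≡ n
  ones-coordinate i = begin
    ones (coordinate i p)     ≡⟨ lookup-position p i ⟨
    lookup (position p) i     ≡⟨ cong (λ x → lookup x i) ends ⟩
    lookup (replicate m n) i  ≡⟨ lookup-replicate i n ⟩
    n                         ∎
    where open ≡-Reasoning

  j<ones : ∀ i (j : Fin n) → toℕ j < ones (coordinate i p)
  j<ones i j = subst (toℕ j <_) (sym (ones-coordinate i)) (toℕ<n j)

  coordinates-precede : ∀ i i′ → toℕ i′ ≡ suc (toℕ i) → OnesPrecede (coordinate i p) (coordinate i′ p)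
  coordinates-precede i i′ i′≡1+i = dominance⇒onesPrecede b b′ dominates noTie
    where
      b = coordinate i p
      b′ = coordinate i′ p
      dominates : ∀ k → k ≤ length b′ → onesBefore k b′ ≤ onesBefore k b
      dominates k k≤ = subst₂ _≤_ (lookup-after p k i′) (lookup-after p k i)
        (inRegion k (subst (k ≤_) (length-coordinate i′ p) k≤) i i′ i′≡1+i)
      noTieAt : ∀ (K : Fin (length p)) → onesBefore (toℕ K) b ≡ onesBefore (toℕ K) b′ →
        bitAt b (toℕ K) ≡ true → bitAt b′ (toℕ K) ≡ true → ⊥
      noTieAt K tie one one′ =
        small K i i′ i′≡1+i (trans (lookup-after p (toℕ K) i) (trans tie (sym (lookup-after p (toℕ K) i′))))
          (trans (lookup-stepAt p K i) one , trans (lookup-stepAt p K i′) one′)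
      noTie : ∀ k → k < length b′ → onesBefore k b ≡ onesBefore k b′ →
        bitAt b k ≡ true → bitAt b′ k ≡ true → ⊥
      noTie k k< = ∀Fin⇒∀< noTieAt k (subst (k <_) (length-coordinate i′ p) k<)

  someCoordinateIsOne : ∀ k → k < length p → ∃[ i ] bitAt (coordinate i p) k ≡ true
  someCoordinateIsOne = ∀Fin⇒∀< λ K → let (i , one) = nonzero K in i , trans (sym (lookup-stepAt p K i)) one

  allTimesAppear : AllUpToAppear (tableauOf {n = n} p) (length p)
  allTimesAppear (suc k) _ k<p = i , j , (begin
    entry (tableauOf p) i j                   ≡⟨ entry-tableauOf p i j ⟩
    suc (indexOfOne b (toℕ j))                ≡⟨ cong (suc ∘ indexOfOne b) (toℕ-fromℕ< j<n) ⟩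
    suc (indexOfOne b (onesBefore k b))       ≡⟨ cong suc (indexOfOne-onesBefore b k one) ⟩
    suc k                                     ∎)
    where
      open ≡-Reasoning
      i = proj₁ (someCoordinateIsOne k k<p)
      one = proj₂ (someCoordinateIsOne k k<p)
      b = coordinate i p
      j<n : onesBefore k b < n
      j<n = subst (onesBefore k b <_) (ones-coordinate i) (onesBefore<ones b k one)
      j : Fin n
      j = fromℕ< j<n

  n≤length : n ≤ length p
  n≤length = begin
    n                              ≡⟨ ones-coordinate i₀ ⟨
    ones (coordinate i₀ p)         ≤⟨ ones≤length (coordinate i₀ p) ⟩
    length (coordinate i₀ p)       ≡⟨ length-coordinate i₀ p ⟩
    length p                       ∎
    where
      open ≤-Reasoning
      i₀ = fromℕ< m≥1

  length≤m*n : length p ≤ m * n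
  length≤m*n = subst (length p ≤_) (trans (cong sum ends) (sum-replicate m n)) (length≤sum-position p nonzero)

  isLargestEntry : IsLargestEntry (tableauOf {n = n} p) (length p)
  isLargestEntry = allTimesAppear (length p) (≤-trans n≥1 n≤length) ≤-refl , atMostLength
    where
      atMostLength : ∀ i j → entry (tableauOf {n = n} p) i j ≤ length p
      atMostLength i j = subst₂ _≤_ (sym (entry-tableauOf p i j)) (length-coordinate i p)
        (indexOfOne<length (coordinate i p) (j<ones i j))

  isIncreasingTableau : IsIncreasingTableau (tableauOf {n = n} p) (length p)
  isIncreasingTableau = positive , rowsIncreasing , columnsIncreasing , isLargestEntry , allTimesAppear
    where
      positive : Positive (tableauOf {n = n} p)
      positive i j = subst (1 ≤_) (sym (entry-tableauOf p i j)) (s≤s z≤n)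
      rowsIncreasing : RowsIncreasing (tableauOf {n = n} p)
      rowsIncreasing i j j′ j′≡1+j = subst₂ _<_ (sym (entry-tableauOf p i j)) (sym (entry-tableauOf p i j′))
        (s≤s (subst (λ x → indexOfOne b (toℕ j) < indexOfOne b x) (sym j′≡1+j)
          (indexOfOne-strictMono b (subst (_< ones b) j′≡1+j (j<ones i j′)))))
        where b = coordinate i p
      columnsIncreasing : ColumnsIncreasing (tableauOf {n = n} p)
      columnsIncreasing i i′ j i′≡1+i = subst₂ _<_ (sym (entry-tableauOf p i j)) (sym (entry-tableauOf p i′ j))
        (s≤s (coordinates-precede i i′ i′≡1+i (j<ones i′ j)))

  pathFrom-tableauOf : pathFrom (tableauOf {n = n} p) (length p) ≡ p
  pathFrom-tableauOf = coordinate-injective (fromℕ< m≥1) _ p λ i → begin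
    coordinate i (pathFrom T (length p))           ≡⟨ coordinate-pathFrom T (length p) i ⟩
    indicator (lookup T i) 1 (length p)            ≡⟨ cong (λ S → indicator S 1 (length p)) (lookup∘tabulate _ i) ⟩
    indicator (row i) 1 (length p)                 ≡⟨ cong (indicator (row i) 1) (length-coordinate i p) ⟨
    indicator (row i) 1 (length (coordinate i p))  ≡⟨ indicator-entriesOf (coordinate i p) (ones-coordinate i) ⟩
    coordinate i p                                 ∎
    where
      open ≡-Reasoning
      T : Filling m n
      T = tableauOf p
      row : Fin m → Vec ℕ n
      row i = entriesOf (coordinate i p)

module TableauToPath {m n : ℕ} (T : Filling m n) (M : ℕ) (positive : Positive T)
  (rowsIncreasing : RowsIncreasing T) (columnsIncreasing : ColumnsIncreasing T)
  (atMostM : ∀ i j → entry T i j ≤ M) (allAppear : AllUpToAppear T M) where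

  p : Path m
  p = pathFrom T M

  word : Fin m → List Bool
  word i = indicator (lookup T i) 1 M

  fits : ∀ i → Fits (lookup T i) 1 M
  fits i = strictlyIncreasing⇒IncreasingFrom 1 (lookup T i) (positive i) (rowsIncreasing i)
         , λ j → s≤s (atMostM i j)

  ones-word : ∀ i → ones (word i) ≡ n
  ones-word i = ones-indicator (lookup T i) 1 M (fits i)

  entry-word : ∀ i j → suc (indexOfOne (word i) (toℕ j)) ≡ entry T i j
  entry-word i = indexOfOne-indicator (lookup T i) 1 M (fits i)

  words-precede : ∀ i i′ → toℕ i′ ≡ suc (toℕ i) → OnesPrecede (word i) (word i′)
  words-precede i i′ i′≡1+i {j} j<ones′ = ∀Fin⇒∀< precedeAt j (subst (j <_) (ones-word i′) j<ones′)
    where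
      precedeAt : ∀ (J : Fin n) → indexOfOne (word i) (toℕ J) < indexOfOne (word i′) (toℕ J)
      precedeAt J = ≤-pred (subst₂ _<_ (sym (entry-word i J)) (sym (entry-word i′ J)) (columnsIncreasing i i′ J i′≡1+i))

  same-ones : ∀ i i′ → ones (word i) ≡ ones (word i′)
  same-ones i i′ = trans (ones-word i) (sym (ones-word i′))

  lookup-after-p : ∀ k i → lookup (after p k) i ≡ onesBefore k (word i)
  lookup-after-p k i = trans (lookup-after p k i) (cong (onesBefore k) (coordinate-pathFrom T M i))

  lookup-stepAt-p : ∀ K i → lookup (stepAt p K) i ≡ bitAt (word i) (toℕ K)
  lookup-stepAt-p K i = trans (lookup-stepAt p K i) (cong (λ b → bitAt b (toℕ K)) (coordinate-pathFrom T M i))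

  isSmallSchroder : IsLargeSchroder n p × SmallCondition p
  isSmallSchroder = (nonzero , inRegion , ends) , small
    where
      nonzeroAt : ∀ k → k < M → ∃[ i ] bitAt (word i) k ≡ true
      nonzeroAt k k<M with allAppear (suc k) (s≤s z≤n) k<M
      ... | i , j , Tij≡1+k = i , subst (λ x → bitAt (word i) x ≡ true)
                                  (suc-injective (trans (entry-word i j) Tij≡1+k))
                                  (bitAt-indexOfOne (word i) (subst (toℕ j <_) (sym (ones-word i)) (toℕ<n j)))
      nonzero : ∀ K → NonzeroStep (stepAt p K)
      nonzero K with nonzeroAt (toℕ K) (subst (toℕ K <_) (length-pathFrom T M) (toℕ<n K))
      ... | i , one = i , trans (lookup-stepAt-p K i) one
      inRegion : ∀ k → k ≤ length p → InRegion (after p k)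
      inRegion k _ i i′ i′≡1+i = subst₂ _≤_ (sym (lookup-after-p k i′)) (sym (lookup-after-p k i))
        (onesPrecede⇒dominance (word i) (word i′) (same-ones i i′) (words-precede i i′ i′≡1+i) k)
      ends : position p ≡ replicate m n
      ends = Pointwise-≡⇒≡ (ext λ i → begin
        lookup (position p) i         ≡⟨ lookup-position p i ⟩
        ones (coordinate i p)         ≡⟨ cong ones (coordinate-pathFrom T M i) ⟩
        ones (word i)                 ≡⟨ ones-word i ⟩
        n                             ≡⟨ lookup-replicate i n ⟨
        lookup (replicate m n) i      ∎)
        where open ≡-Reasoning
      small : SmallCondition p
      small K i i′ i′≡1+i tie (one , one′) =
        onesPrecede⇒noJointOneAtTie (word i) (word i′) (words-precede i i′ i′≡1+i) (toℕ K)
          (trans (sym (lookup-after-p (toℕ K) i)) (trans tie (lookup-after-p (toℕ K) i′)))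
          (trans (sym (lookup-stepAt-p K i)) one) (trans (sym (lookup-stepAt-p K i′)) one′)

  tableauOf-pathFrom : tableauOf p ≡ T
  tableauOf-pathFrom = filling-ext (tableauOf p) T λ i j → begin
    entry (tableauOf p) i j                    ≡⟨ entry-tableauOf p i j ⟩
    suc (indexOfOne (coordinate i p) (toℕ j))  ≡⟨ cong (λ b → suc (indexOfOne b (toℕ j))) (coordinate-pathFrom T M i) ⟩
    suc (indexOfOne (word i) (toℕ j))          ≡⟨ entry-word i j ⟩
    entry T i j                                ∎
    where open ≡-Reasoning

toPath : ∀ {m n} → AllInc m n → SmallSchroder m n
toPath {m} {n} (k , T , positive , rows , columns , (_ , atMost) , allAppear) =
  pathFrom T (m * n ∸ k) , TableauToPath.isSmallSchroder T (m * n ∸ k) positive rows columns atMost allAppear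

tableauOf-toPath : ∀ {m n} (y : AllInc m n) → tableauOf (pathOf (toPath y)) ≡ fillingOf y
tableauOf-toPath {m} {n} (k , T , positive , rows , columns , (_ , atMost) , allAppear) =
  TableauToPath.tableauOf-pathFrom T (m * n ∸ k) positive rows columns atMost allAppear

module _ {m n : ℕ} (m≥1 : 1 ≤ m) (n≥1 : 1 ≤ n) where

  toTableau : SmallSchroder m n → AllInc m n
  toTableau (p , (nonzero , inRegion , ends) , small) =
    m * n ∸ length p , tableauOf p ,
    subst (IsIncreasingTableau (tableauOf p)) (sym (m∸[m∸n]≡n P.length≤m*n)) P.isIncreasingTableau
    where module P = PathToTableau m≥1 n≥1 p nonzero inRegion ends small

  tableauOf-injective : (x y : SmallSchroder m n) →
    tableauOf {n = n} (pathOf x) ≡ tableauOf (pathOf y) → pathOf x ≡ pathOf y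
  tableauOf-injective (p , (nz , reg , ends) , sm) (q , (nz′ , reg′ , ends′) , sm′) sameTableau = begin
    p                                  ≡⟨ P.pathFrom-tableauOf ⟨
    pathFrom (tableauOf p) (length p)  ≡⟨ cong₂ pathFrom sameTableau sameLength ⟩
    pathFrom (tableauOf q) (length q)  ≡⟨ Q.pathFrom-tableauOf ⟩
    q                                  ∎
    where
      open ≡-Reasoning
      module P = PathToTableau m≥1 n≥1 p nz reg ends sm
      module Q = PathToTableau m≥1 n≥1 q nz′ reg′ ends′ sm′
      sameLength : length p ≡ length q
      sameLength = largestEntry-unique (tableauOf q)
        (subst (λ T → IsLargestEntry T (length p)) sameTableau P.isLargestEntry) Q.isLargestEntry

theorem2p9 : (m n : ℕ) → 2 ≤ m → 1 ≤ n →
    Bijection (SmallSchroderSetoid m n) (AllIncSetoid m n)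
theorem2p9 m n m≥2 n≥1 = record
  { to        = toTableau m≥1 n≥1
  ; cong      = cong tableauOf
  ; bijective = (λ {x} {y} → tableauOf-injective m≥1 n≥1 x y)
              , λ y → toPath y , λ z≡toPath → trans (cong tableauOf z≡toPath) (tableauOf-toPath y)
  }
  where
    m≥1 : 1 ≤ m
    m≥1 = ≤-trans (s≤s z≤n) m≥2
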